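{- Let $k \ge 1$ and $1 \le r, s \le k$. If $s \ge 2r - 1$, then $d_k(P_r \Box P_{k+1+s}) = 2r$.
   Context: $P_n$ is the path on $n$ vertices ($P_1$ a single vertex); $P_m \Box P_n$ is the Cartesian product ($m\times n$ grid): vertices $(i,j)$, $0\le i\le m-1$, $0\le j\le n-1$, with $(i,j)$ adjacent to $(i',j')$ iff ($|i-i'|=1$ and $j=j'$) or ($i=i'$ and $|j-j'|=1$). The $k$-move deduction game ($k$ a positive integer) on a finite graph $G$: a layout places a finite number of searchers on vertices of $G$ (several searchers may share a vertex). Every searcher is initially mobile. A vertex is protected once it has been occupied by some searcher (so initially occupied vertices are protected); other vertices are unprotected. The game proceeds in stages. At each stage, for every vertex $v$ that has at least one unprotected neighbour: if the number of mobile searchers on $v$ is at least the number of unprotected neighbours of $v$, then the mobile searchers on $v$ move to the unprotected neighbours of $v$ so that each unprotected neighbour receives at least one searcher; excess mobile searchers on $v$ may also move to any of these unprotected neighbours. All moves in a stage happen simultaneously, newly occupied vertices become protected, and a searcher that has moved $k$ times becomes immobile. The process repeats until all vertices are protected or no searcher can move. A layout is successful if all vertices of $G$ end up protected. The $k$-move deduction number $d_k(G)$ is the minimum number of searchers in a successful layout on $G$. -}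

module Defs where

open import Data.Bool using (Bool; true; false; _∧_; _∨_; not; T)
open import Data.Nat using (ℕ; zero; suc; _+_; _*_; _≤_; _<_; _<?_; ∣_-_∣)
import Data.Nat as ℕ
open import Data.Fin using (Fin; toℕ)
import Data.Fin as Fin
open import Data.List using (List; length; filterᵇ; cartesianProduct; allFin; filter)
open import Data.Bool.ListAction using (any)
open import Data.Product using (_×_; _,_; Σ; ∃; ∃-syntax; proj₁; proj₂)
open import Relation.Nullary using (does; ¬_)
open import Relation.Binary.PropositionalEquality using (_≡_)
open import Relation.Binary.Definitions using (DecidableEquality)
open import Relation.Binary.Construct.Closure.ReflexiveTransitive using (Star)
import Data.Product.Properties as ×ₚ

record FinGraph : Set₁ where
  field
    V     : Set
    _≟_   : DecidableEquality V
    verts : List V        -- every vertex exactly once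
    adj   : V → V → Bool

gridAdj : {m n : ℕ} → Fin m × Fin n → Fin m × Fin n → Bool
gridAdj (i , j) (i' , j') =
     (does (∣ toℕ i - toℕ i' ∣ ℕ.≟ 1) ∧ does (j Fin.≟ j'))
  ∨ (does (i Fin.≟ i') ∧ does (∣ toℕ j - toℕ j' ∣ ℕ.≟ 1))

Grid : ℕ → ℕ → FinGraph
Grid m n = record
  { V     = Fin m × Fin n
  ; _≟_   = ×ₚ.≡-dec Fin._≟_ Fin._≟_
  ; verts = cartesianProduct (allFin m) (allFin n)
  ; adj   = gridAdj
  }

module Game (G : FinGraph) (k : ℕ) where
  open FinGraph G

  record State (s : ℕ) : Set where
    constructor state
    field
      pos  : Fin s → V
      cnt  : Fin s → ℕ
      prot : V → Bool

  open State public

  module _ {s : ℕ} where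

    mobile : State s → Fin s → Bool
    mobile st i = does (cnt st i <? k)

    unprotNbrs : State s → V → ℕ
    unprotNbrs st v = length (filterᵇ (λ w → adj v w ∧ not (prot st w)) verts)

    mobileOn : State s → V → ℕ
    mobileOn st v = length (filterᵇ (λ i → does (pos st i ≟ v) ∧ mobile st i) (allFin s))

    Fires : State s → V → Set
    Fires st v = 1 ≤ unprotNbrs st v × unprotNbrs st v ≤ mobileOn st v

    Moves : State s → Fin s → Set
    Moves st i = T (mobile st i) × Fires st (pos st i)

    protectAfter : (V → Bool) → (Fin s → V) → V → Bool
    protectAfter pr p w = pr w ∨ any (λ i → does (p i ≟ w)) (allFin s)

    record Stage (st st' : State s) : Set where
      field
        moving  : ∀ i → Moves st i →
                    T (adj (pos st i) (pos st' i))
                  × prot st (pos st' i) ≡ false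
                  × cnt st' i ≡ suc (cnt st i)
        staying : ∀ i → ¬ Moves st i →
                    pos st' i ≡ pos st i × cnt st' i ≡ cnt st i
        covered : ∀ v → Fires st v → ∀ w → T (adj v w) → prot st w ≡ false →
                    ∃[ i ] (pos st i ≡ v × T (mobile st i) × pos st' i ≡ w)
        protUpd : ∀ w → prot st' w ≡ protectAfter (prot st) (pos st') w

    initial : (Fin s → V) → State s
    initial p = state p (λ _ → 0) (protectAfter (λ _ → false) p)

    AllProtected : State s → Set
    AllProtected st = ∀ v → prot st v ≡ true

    Successful : (Fin s → V) → Set
    Successful p = ∃[ st ] (Star Stage (initial p) st × AllProtected st)

  IsDeductionNumber : ℕ → Set
  IsDeductionNumber d =
      (∃[ p ] Successful {d} p)
    × (∀ (s : ℕ) (p : Fin s → V) → Successful {s} p → d ≤ s)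

{-# OPTIONS --safe #-}

-- Upper bound: r searchers on each end column form two walls; at every stage each searcher has exactly one
-- unprotected neighbour, the next cell of its row, so the walls advance one column per stage and meet after
-- ⌊(k + s)/2⌋ ≤ k stages.
--
-- Lower bound: a protected vertex with an unprotected neighbour is always occupied. Take the r × r blocks on
-- the first r columns and on columns k + r, …, k + 2r − 1. At the first moment a block contains a fully
-- protected row (or column), each column (row) of the block holds a searcher, either on a freshly protected
-- cell or on a protected cell next to an unprotected one; this gives r distinct searchers per block. A searcher
-- moves at most k columns during the whole play, and the blocks are more than k columns apart since
-- 2r − 1 ≤ s, so the 2r searchers are distinct.

module Submission where

open import Defs
open import Data.Bool using (Bool; true; false; _∧_; _∨_; not; T)
open import Data.Bool.Properties using (T-∧; T-∨; T-≡; T-not-≡; ∨-zeroʳ; ¬-not)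
open import Data.Bool.ListAction using (any)
open import Data.Fin using (Fin; zero; suc; toℕ; fromℕ<; splitAt; join; remQuot; combine)
open import Data.Fin.Properties using (toℕ-fromℕ<; toℕ-injective; toℕ<n; any?; all?; ¬∀⟶∃¬; injective⇒≤; join-splitAt; remQuot-combine)
open import Data.List using ([]; _∷_; length; filterᵇ; allFin)
open import Data.List.Membership.Propositional using (_∈_; lose)
open import Data.List.Membership.Propositional.Properties using (∈-allFin; ∈-filter⁺; ∈-filter⁻; ∈-length; ∈-cartesianProduct⁺)
open import Data.List.Relation.Unary.All using ([]; _∷_)
open import Data.List.Relation.Unary.AllPairs using ([]; _∷_)
open import Data.List.Relation.Unary.Any using (here; there; satisfied)
open import Data.List.Relation.Unary.Any.Properties using (any⁺; any⁻)
open import Data.List.Relation.Unary.Unique.Propositional using (Unique)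
open import Data.List.Relation.Unary.Unique.Propositional.Properties using (filter⁺; cartesianProduct⁺; allFin⁺)
open import Data.Nat using (ℕ; zero; suc; _+_; _*_; _∸_; _≤_; _<_; z≤n; s≤s; s≤s⁻¹; ∣_-_∣; ⌊_/2⌋)
open import Data.Nat.Properties hiding (_≟_)
open import Algebra.Properties.CommutativeSemigroup +-commutativeSemigroup using (interchange)
open import Data.Product using (_×_; _,_; proj₁; proj₂; ∃; ∃₂; ∃-syntax; Σ)
open import Data.Sum using (_⊎_; inj₁; inj₂; [_,_]′)
open import Function using (_∘_)
open import Function.Bundles using (Equivalence; _⇔_; mk⇔)
open import Function.Definitions using (Injective)
import Function.Construct.Composition as Composition
open import Relation.Binary.Construct.Closure.ReflexiveTransitive using (Star; ε; _◅_; _◅◅_)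
open import Relation.Binary.PropositionalEquality
open import Relation.Nullary using (Dec; yes; no; does; ¬_; contradiction)
open import Relation.Nullary.Decidable using (T?; _×-dec_; _⊎-dec_)

open Equivalence using (to; from)

T-does : ∀ {P : Set} (P? : Dec P) → T (does P?) ⇔ P
T-does (yes p) = mk⇔ (λ _ → p) _
T-does (no ¬p) = mk⇔ (λ ()) ¬p

m+m≤n+n⇒m≤n : ∀ {m n} → m + m ≤ n + n → m ≤ n
m+m≤n+n⇒m≤n m+m≤n+n = ≮⇒≥ λ n<m → <⇒≱ (+-mono-< n<m n<m) m+m≤n+n

∣m-n∣≡1⇒n≡1+m⊎m≡1+n : ∀ {m n} → ∣ m - n ∣ ≡ 1 → n ≡ suc m ⊎ m ≡ suc n
∣m-n∣≡1⇒n≡1+m⊎m≡1+n {zero}  {suc zero} _ = inj₁ refl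
∣m-n∣≡1⇒n≡1+m⊎m≡1+n {suc zero} {zero}  _ = inj₂ refl
∣m-n∣≡1⇒n≡1+m⊎m≡1+n {suc m} {suc n} eq = Data.Sum.map (cong suc) (cong suc) (∣m-n∣≡1⇒n≡1+m⊎m≡1+n eq)

∣n-1+n∣≡1 : ∀ n → ∣ n - suc n ∣ ≡ 1
∣n-1+n∣≡1 n = trans (cong ∣ n -_∣ (+-comm 1 n)) (∣m-m+n∣≡n n 1)

⌊n/2⌋-bounds : ∀ n → ⌊ n /2⌋ + ⌊ n /2⌋ ≤ n × n ≤ suc (⌊ n /2⌋ + ⌊ n /2⌋)
⌊n/2⌋-bounds zero = z≤n , z≤n
⌊n/2⌋-bounds (suc zero) = z≤n , s≤s z≤n
⌊n/2⌋-bounds (suc (suc n)) = let (lower , upper) = ⌊n/2⌋-bounds n ; h = ⌊ n /2⌋ in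
  subst (_≤ suc (suc n)) (cong suc (sym (+-suc h h))) (s≤s (s≤s lower)) ,
  subst (suc (suc n) ≤_) (cong (λ x → suc (suc x)) (sym (+-suc h h))) (s≤s (s≤s upper))

m∸n≤1+[m∸1+n] : ∀ m n → m ∸ n ≤ suc (m ∸ suc n)
m∸n≤1+[m∸1+n] m n = m≤n+o⇒m∸n≤o m n (subst (m ≤_) (sym (+-suc n (m ∸ suc n))) (m≤n+m∸n m (suc n)))

Consecutive : ∀ {n} → Fin n → Fin n → Set
Consecutive i j = ∣ toℕ i - toℕ j ∣ ≡ 1

Boundary : ∀ {n} → (Fin n → Bool) → Set
Boundary f = ∃₂ λ x y → Consecutive x y × f x ≡ true × f y ≡ false

boundary-suc : ∀ {n} {f : Fin (suc n) → Bool} → Boundary (f ∘ suc) → Boundary f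
boundary-suc (x , y , c , fx , fy) = suc x , suc y , c , fx , fy

true-or-false : ∀ b → b ≡ true ⊎ b ≡ false
true-or-false true  = inj₁ refl
true-or-false false = inj₂ refl

boundary : ∀ {n} (f : Fin n → Bool) {u v} → f u ≡ true → f v ≡ false → Boundary f
boundary f {zero} {zero} fu fv = contradiction (trans (sym fu) fv) λ ()
boundary f {zero} {suc zero} fu fv = zero , suc zero , refl , fu , fv
boundary f {zero} {suc (suc v)} fu fv =
  [ (λ f1 → boundary-suc (boundary (f ∘ suc) {zero} {suc v} f1 fv))
  , (λ f1 → zero , suc zero , refl , fu , f1)
  ]′ (true-or-false (f (suc zero)))
boundary f {suc zero} {zero} fu fv = suc zero , zero , refl , fu , fv
boundary f {suc (suc u)} {zero} fu fv =
  [ (λ f1 → suc zero , zero , refl , f1 , fv)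
  , (λ f1 → boundary-suc (boundary (f ∘ suc) {suc u} {zero} fu f1))
  ]′ (true-or-false (f (suc zero)))
boundary f {suc u} {suc v} fu fv = boundary-suc (boundary (f ∘ suc) fu fv)

splitAt-injective : ∀ m {n} → Injective _≡_ _≡_ (splitAt m {n})
splitAt-injective m {n} {i} {j} eq = begin
  i                     ≡⟨ sym (join-splitAt m n i) ⟩
  join m n (splitAt m i) ≡⟨ cong (join m n) eq ⟩
  join m n (splitAt m j) ≡⟨ join-splitAt m n j ⟩
  j                     ∎
  where open ≡-Reasoning

module _ {A : Set} where

  unique-length≤1 : ∀ {y : A} {xs} → Unique xs → (∀ {x} → x ∈ xs → x ≡ y) → length xs ≤ 1
  unique-length≤1 [] _ = z≤n
  unique-length≤1 ([] ∷ []) _ = s≤s z≤n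
  unique-length≤1 ((x≢x′ ∷ _) ∷ _) ≡y = contradiction (trans (≡y (here refl)) (sym (≡y (there (here refl))))) x≢x′

  length-filterᵇ≥1 : ∀ (f : A → Bool) {x xs} → x ∈ xs → T (f x) → 1 ≤ length (filterᵇ f xs)
  length-filterᵇ≥1 f x∈xs fx = ∈-length (∈-filter⁺ (T? ∘ f) x∈xs fx)

  length-filterᵇ≤1 : ∀ (f : A → Bool) {y xs} → Unique xs → (∀ {x} → T (f x) → x ≡ y) →
                     length (filterᵇ f xs) ≤ 1
  length-filterᵇ≤1 f {xs = xs} unique ≡y =
    unique-length≤1 (filter⁺ (T? ∘ f) unique) (≡y ∘ proj₂ ∘ ∈-filter⁻ (T? ∘ f) {xs = xs})

  filterᵇ-witness : ∀ (f : A → Bool) xs → 1 ≤ length (filterᵇ f xs) → ∃[ x ] T (f x)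
  filterᵇ-witness f xs nonempty with filterᵇ f xs in eq
  ... | x ∷ _ = x , proj₂ (∈-filter⁻ (T? ∘ f) {xs = xs} (subst (x ∈_) (sym eq) (here refl)))

  injective-[,] : ∀ {B C : Set} {f : A → C} {g : B → C} → Injective _≡_ _≡_ f → Injective _≡_ _≡_ g →
                  (∀ a b → f a ≢ g b) → Injective _≡_ _≡_ [ f , g ]′
  injective-[,] f-inj _ _ {inj₁ a} {inj₁ a′} eq = cong inj₁ (f-inj eq)
  injective-[,] _ g-inj _ {inj₂ b} {inj₂ b′} eq = cong inj₂ (g-inj eq)
  injective-[,] _ _ f≢g {inj₁ a} {inj₂ b} eq = contradiction eq (f≢g a b)
  injective-[,] _ _ f≢g {inj₂ b} {inj₁ a} eq = contradiction (sym eq) (f≢g a b)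

module Shapes (G : FinGraph) where
  open FinGraph G

  Lipschitz : (V → ℕ) → Set
  Lipschitz φ = ∀ v w → T (adj v w) → ∣ φ v - φ w ∣ ≤ 1

  record Square (n : ℕ) : Set where
    field
      cell           : Fin n → Fin n → V
      cell-injective : ∀ {a b a′ b′} → cell a b ≡ cell a′ b′ → a ≡ a′ × b ≡ b′
      adj-row        : ∀ a {b b′} → Consecutive b b′ → T (adj (cell a b) (cell a b′))
      adj-column     : ∀ b {a a′} → Consecutive a a′ → T (adj (cell a b) (cell a′ b))

  open Square public

  transpose : ∀ {n} → Square n → Square n
  transpose sq = record
    { cell           = λ a b → cell sq b a
    ; cell-injective = λ eq → let (b≡b′ , a≡a′) = cell-injective sq eq in a≡a′ , b≡b′
    ; adj-row        = adj-column sq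
    ; adj-column     = adj-row sq
    }

  module _ {n : ℕ} (sq : Square n) where

    Inside : V → Set
    Inside v = ∃₂ λ a b → cell sq a b ≡ v

    FullColumn : (V → Bool) → Fin n → Set
    FullColumn P b = ∀ a → P (cell sq a b) ≡ true

  FullRow : ∀ {n} → Square n → (V → Bool) → Fin n → Set
  FullRow sq = FullColumn (transpose sq)

  HasFullLine : ∀ {n} → Square n → (V → Bool) → Set
  HasFullLine sq P = ∃ (FullColumn sq P) ⊎ ∃ (FullRow sq P)

  hasFullLine? : ∀ {n} (sq : Square n) P → Dec (HasFullLine sq P)
  hasFullLine? sq P = full? sq ⊎-dec full? (transpose sq)
    where full? : ∀ {n} (sq : Square n) → Dec (∃ (FullColumn sq P))
          full? sq = any? λ b → all? λ a → P (cell sq a b) Data.Bool.≟ true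

module Play (G : FinGraph) (k : ℕ) where
  open FinGraph G
  open Game G k
  open Shapes G

  module _ {m : ℕ} where

    Occupied : State m → V → Set
    Occupied st v = ∃[ i ] pos st i ≡ v

    protectAfter-old : ∀ Q (p : Fin m → V) {w} → Q w ≡ true → protectAfter Q p w ≡ true
    protectAfter-old Q p Qw = cong (_∨ _) Qw

    protectAfter-new : ∀ Q (p : Fin m → V) {w} → ∃[ i ] p i ≡ w → protectAfter Q p w ≡ true
    protectAfter-new Q p {w} (i , pi≡w) = trans (cong (Q w ∨_) some) (∨-zeroʳ (Q w))
      where
        some : any (λ j → does (p j ≟ w)) (allFin m) ≡ true
        some = to T-≡ (any⁺ _ (lose (∈-allFin i) (from (T-does (p i ≟ w)) pi≡w)))

    protectAfter-cases : ∀ Q (p : Fin m → V) {w} → protectAfter Q p w ≡ true → Q w ≡ true ⊎ ∃[ i ] p i ≡ w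
    protectAfter-cases Q p {w} protected with to T-∨ (from T-≡ protected)
    ... | inj₁ Qw   = inj₁ (to T-≡ Qw)
    ... | inj₂ some = let (i , pi≟w) = satisfied (any⁻ _ (allFin m) some) in inj₂ (i , to (T-does (p i ≟ w)) pi≟w)

    protectAfter-false : ∀ Q (p : Fin m → V) {w} → Q w ≡ false → (∀ i → p i ≢ w) → protectAfter Q p w ≡ false
    protectAfter-false Q p {w} Qw p≢w with protectAfter Q p w in protected
    ... | false = refl
    ... | true with protectAfter-cases Q p protected
    ...   | inj₁ Qw′       = contradiction (trans (sym Qw) Qw′) λ ()
    ...   | inj₂ (i , pi≡w) = contradiction pi≡w (p≢w i)

    moves? : (st : State m) → ∀ i → Dec (Moves st i)
    moves? st i = T? (mobile st i) ×-dec (1 ≤? unprotNbrs st v ×-dec unprotNbrs st v ≤? mobileOn st v)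
      where v = pos st i

    stage-cases : ∀ {st st′} → Stage st st′ → ∀ i →
                    (T (mobile st i) × T (adj (pos st i) (pos st′ i)) × cnt st′ i ≡ suc (cnt st i))
                  ⊎ (pos st′ i ≡ pos st i × cnt st′ i ≡ cnt st i)
    stage-cases {st} S i with moves? st i
    ... | yes moves@(mobile-i , _) = let (adj-i , _ , cnt≡) = Stage.moving S i moves in inj₁ (mobile-i , adj-i , cnt≡)
    ... | no ¬moves = inj₂ (Stage.staying S i ¬moves)

    occupied-protected : ∀ {st st′} → Stage st st′ → ∀ i → prot st′ (pos st′ i) ≡ true
    occupied-protected {st} {st′} S i = trans (Stage.protUpd S _) (protectAfter-new (prot st) (pos st′) (i , refl))

    unprotected-before : ∀ {st st′ w} → Stage st st′ → prot st′ w ≡ false → prot st w ≡ false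
    unprotected-before {st} {st′} {w} S st′-w with prot st w in st-w
    ... | false = refl
    ... | true  = contradiction (trans (sym (trans (Stage.protUpd S w) (protectAfter-old (prot st) (pos st′) st-w))) st′-w) λ ()

    newly-protected-occupied : ∀ {st st′ w} → Stage st st′ → prot st w ≡ false → prot st′ w ≡ true → Occupied st′ w
    newly-protected-occupied {st} {st′} {w} S st-w st′-w
      with protectAfter-cases (prot st) (pos st′) (trans (sym (Stage.protUpd S w)) st′-w)
    ... | inj₁ st-w′  = contradiction (trans (sym st-w) st-w′) λ ()
    ... | inj₂ occupied = occupied

    initially-protected-occupied : ∀ (p : Fin m → V) {w} → prot (initial p) w ≡ true → Occupied (initial p) w
    initially-protected-occupied p protected with protectAfter-cases (λ _ → false) p protected
    ... | inj₂ occupied = occupied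

    FrontierOccupied : State m → Set
    FrontierOccupied st = ∀ {v w} → prot st v ≡ true → T (adj v w) → prot st w ≡ false → Occupied st v

    frontierOccupied-initial : ∀ p → FrontierOccupied (initial p)
    frontierOccupied-initial p protected _ _ = initially-protected-occupied p protected

    -- A searcher leaving v fires, so v's unprotected neighbour w would receive a searcher and become protected.
    frontierOccupied-step : ∀ {st st′} → Stage st st′ → FrontierOccupied st → FrontierOccupied st′
    frontierOccupied-step {st} {st′} S frontier {v} {w} st′-v vw st′-w with prot st v in st-v
    ... | false = newly-protected-occupied S st-v st′-v
    ... | true with frontier st-v vw (unprotected-before S st′-w)
    ...   | i , pi≡v with moves? st i
    ...     | no ¬moves = i , trans (proj₁ (Stage.staying S i ¬moves)) pi≡v
    ...     | yes (_ , fires) with Stage.covered S v (subst (Fires st) pi≡v fires) w vw (unprotected-before S st′-w)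
    ...       | j , _ , _ , pj≡w =
      contradiction (trans (sym (subst (λ u → prot st′ u ≡ true) pj≡w (occupied-protected S j))) st′-w) λ ()

    moves-bounded : ∀ {st st′} → Star Stage st st′ → (∀ i → cnt st i ≤ k) → ∀ i → cnt st′ i ≤ k
    moves-bounded ε bounded = bounded
    moves-bounded {st} (_◅_ {j = st′} S play) bounded = moves-bounded play bounded′
      where
        bounded′ : ∀ i → cnt st′ i ≤ k
        bounded′ i with stage-cases S i
        ... | inj₁ (mobile-i , _ , cnt≡) = subst (_≤ k) (sym cnt≡) (to (T-does (cnt st i <? k)) mobile-i)
        ... | inj₂ (_ , cnt≡)            = subst (_≤ k) (sym cnt≡) (bounded i)

    module _ {φ : V → ℕ} (φ-lipschitz : Lipschitz φ) where

      displacement-step : ∀ {st st′} → Stage st st′ → ∀ i → ∣ φ (pos st i) - φ (pos st′ i) ∣ + cnt st i ≤ cnt st′ i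
      displacement-step {st} {st′} S i with stage-cases S i
      ... | inj₁ (_ , vw , cnt≡) = subst (_ ≤_) (sym cnt≡) (+-monoˡ-≤ (cnt st i) (φ-lipschitz _ _ vw))
      ... | inj₂ (pos≡ , cnt≡)   = ≤-reflexive (begin
        ∣ φ (pos st i) - φ (pos st′ i) ∣ + cnt st i ≡⟨ cong (λ v → ∣ φ (pos st i) - φ v ∣ + cnt st i) pos≡ ⟩
        ∣ φ (pos st i) - φ (pos st i) ∣ + cnt st i ≡⟨ cong (_+ cnt st i) (∣n-n∣≡0 (φ (pos st i))) ⟩
        cnt st i                                   ≡⟨ sym cnt≡ ⟩
        cnt st′ i                                  ∎)
        where open ≡-Reasoning

      displacement : ∀ {st st′} → Star Stage st st′ → ∀ i → ∣ φ (pos st i) - φ (pos st′ i) ∣ + cnt st i ≤ cnt st′ i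
      displacement {st} ε i = ≤-reflexive (cong (_+ cnt st i) (∣n-n∣≡0 (φ (pos st i))))
      displacement {st} {st″} (_◅_ {j = st′} S play) i = begin
        ∣ a - c ∣ + cnt st i             ≤⟨ +-monoˡ-≤ (cnt st i) (∣-∣-triangle a b c) ⟩
        ∣ a - b ∣ + ∣ b - c ∣ + cnt st i   ≡⟨ cong (_+ cnt st i) (+-comm ∣ a - b ∣ ∣ b - c ∣) ⟩
        ∣ b - c ∣ + ∣ a - b ∣ + cnt st i   ≡⟨ +-assoc ∣ b - c ∣ ∣ a - b ∣ (cnt st i) ⟩
        ∣ b - c ∣ + (∣ a - b ∣ + cnt st i) ≤⟨ +-monoʳ-≤ ∣ b - c ∣ (displacement-step S i) ⟩
        ∣ b - c ∣ + cnt st′ i            ≤⟨ displacement play i ⟩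
        cnt st″ i                       ∎
        where
          open ≤-Reasoning
          a b c : ℕ
          a = φ (pos st i); b = φ (pos st′ i); c = φ (pos st″ i)

      -- A searcher's total displacement is bounded both by the moves it made before and by those it made
      -- after any two moments of a play; the two bounds add up to at most 2k.
      displacement-within-play : ∀ {p : Fin m → V} {x y f} →
                                 Star Stage (initial p) x → Star Stage x f → Star Stage (initial p) y → Star Stage y f →
                                 ∀ i → ∣ φ (pos x i) - φ (pos y i) ∣ ≤ k
      displacement-within-play {p} {x} {y} {f} px xf py yf i = m+m≤n+n⇒m≤n (begin
        d + d                               ≤⟨ +-mono-≤ (∣-∣-triangle a o b) (∣-∣-triangle a e b) ⟩
        (∣ a - o ∣ + ∣ o - b ∣) + (∣ a - e ∣ + ∣ e - b ∣)   ≡⟨ cong₂ (λ u v → (u + ∣ o - b ∣) + (∣ a - e ∣ + v))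
                                                             (∣-∣-comm a o) (∣-∣-comm e b) ⟩
        (∣ o - a ∣ + ∣ o - b ∣) + (∣ a - e ∣ + ∣ b - e ∣)   ≤⟨ +-monoˡ-≤ _ (+-mono-≤ (from-start px) (from-start py)) ⟩
        (nx + ny) + (∣ a - e ∣ + ∣ b - e ∣)                 ≡⟨ +-comm (nx + ny) _ ⟩
        (∣ a - e ∣ + ∣ b - e ∣) + (nx + ny)                 ≡⟨ interchange ∣ a - e ∣ ∣ b - e ∣ nx ny ⟩
        (∣ a - e ∣ + nx) + (∣ b - e ∣ + ny)                 ≤⟨ +-mono-≤ (to-end xf) (to-end yf) ⟩
        k + k                                              ∎)
        where
          open ≤-Reasoning
          a b o e nx ny d : ℕ
          a = φ (pos x i); b = φ (pos y i); o = φ (p i); e = φ (pos f i)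
          nx = cnt x i; ny = cnt y i
          d = ∣ a - b ∣
          from-start : ∀ {z} → Star Stage (initial p) z → ∣ o - φ (pos z i) ∣ ≤ cnt z i
          from-start play = subst (_≤ _) (+-identityʳ _) (displacement play i)
          to-end : ∀ {z} → Star Stage z f → ∣ φ (pos z i) - e ∣ + cnt z i ≤ k
          to-end play = ≤-trans (displacement play i) (moves-bounded (px ◅◅ xf) (λ _ → z≤n) i)

    module _ (verts-complete : ∀ v → v ∈ verts) (verts-unique : Unique verts) where

      advance : (st : State m) (next : Fin m → V) →
                (∀ i → T (mobile st i)) →
                (∀ i → T (adj (pos st i) (next i))) →
                (∀ i → prot st (next i) ≡ false) →
                (∀ i {w} → T (adj (pos st i) w) → prot st w ≡ false → w ≡ next i) →
                Stage st (state next (suc ∘ cnt st) (protectAfter (prot st) next))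
      advance st next all-mobile adj-next free-next only-next = record
        { moving  = λ i _ → adj-next i , free-next i , refl
        ; staying = λ i ¬moves → contradiction (moves i) ¬moves
        ; covered = covered
        ; protUpd = λ _ → refl
        }
        where
          free-neighbour : ∀ {v w} → T (adj v w ∧ not (prot st w)) → T (adj v w) × prot st w ≡ false
          free-neighbour vw = let (adj-vw , free-w) = to T-∧ vw in adj-vw , to T-not-≡ free-w

          moves : ∀ i → Moves st i
          moves i = all-mobile i , one-free , ≤-trans at-most-one-free self-mobile
            where
              one-free : 1 ≤ unprotNbrs st (pos st i)
              one-free = length-filterᵇ≥1 _ (verts-complete (next i)) (from T-∧ (adj-next i , from T-not-≡ (free-next i)))
              at-most-one-free : unprotNbrs st (pos st i) ≤ 1
              at-most-one-free = length-filterᵇ≤1 _ verts-unique λ t → let (vw , free) = free-neighbour t in only-next i vw free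
              self-mobile : 1 ≤ mobileOn st (pos st i)
              self-mobile = length-filterᵇ≥1 _ (∈-allFin i) (from T-∧ (from (T-does (pos st i ≟ pos st i)) refl , all-mobile i))

          covered : ∀ v → Fires st v → ∀ w → T (adj v w) → prot st w ≡ false →
                    ∃[ i ] (pos st i ≡ v × T (mobile st i) × next i ≡ w)
          covered v (one-free , enough) w vw free-w =
            let (i , on-v-mobile) = filterᵇ-witness _ (allFin m) (≤-trans one-free enough)
                (on-v , mobile-i) = to T-∧ on-v-mobile
                pi≡v = to (T-does (pos st i ≟ v)) on-v
            in i , pi≡v , mobile-i , sym (only-next i (subst (λ u → T (adj u w)) (sym pi≡v) vw) free-w)

    SearchersInside : ∀ {n} → Square n → State m → Set
    SearchersInside {n} sq st = Σ (Fin n → Fin m) λ g → Injective _≡_ _≡_ g × ∀ a → Inside sq (pos st (g a))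

    searchersInside-transpose : ∀ {n} (sq : Square n) {st} → SearchersInside (transpose sq) st → SearchersInside sq st
    searchersInside-transpose sq (g , g-injective , inside) = g , g-injective , λ a → let (b , c , eq) = inside a in c , b , eq

    rows-occupied⇒searchersInside : ∀ {n} (sq : Square n) {st} → (∀ a → ∃[ b ] Occupied st (cell sq a b)) →
                                    SearchersInside sq st
    rows-occupied⇒searchersInside {n} sq {st} occupied = searcher , injective , inside
      where
        searcher : Fin n → Fin m
        searcher a = proj₁ (proj₂ (occupied a))
        at : ∀ a → pos st (searcher a) ≡ cell sq a (proj₁ (occupied a))
        at a = proj₂ (proj₂ (occupied a))
        injective : Injective _≡_ _≡_ searcher
        injective {a} {a′} eq = proj₁ (cell-injective sq (trans (sym (at a)) (trans (cong (pos st) eq) (at a′))))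
        inside : ∀ a → Inside sq (pos st (searcher a))
        inside a = a , proj₁ (occupied a) , sym (at a)

    every-row-occupied : ∀ {n} (sq : Square n) (old : V → Bool) (st : State m) → FrontierOccupied st →
                         (∀ {v} → old v ≡ false → prot st v ≡ true → Occupied st v) →
                         (∀ a → ¬ FullRow sq old a) → ∃ (FullColumn sq (prot st)) →
                         ∀ a → ∃[ b ] Occupied st (cell sq a b)
    every-row-occupied {n} sq old st frontier fresh no-old-row (b , column) a
      with all? (λ c → prot st (cell sq a c) Data.Bool.≟ true)
    ... | yes row =
      let (c , ¬old) = ¬∀⟶∃¬ n _ (λ c → old (cell sq a c) Data.Bool.≟ true) (no-old-row a)
      in c , fresh (¬-not ¬old) (row c)
    ... | no ¬row =
      let (c , ¬prot) = ¬∀⟶∃¬ n _ (λ c → prot st (cell sq a c) Data.Bool.≟ true) ¬row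
          (x , y , xy , px , py) = boundary (λ c → prot st (cell sq a c)) (column a) (¬-not ¬prot)
      in x , frontier px (adj-row sq a xy) py

    searchersInside-at-first-full-line : ∀ {n} (sq : Square n) (old : V → Bool) (st : State m) → FrontierOccupied st →
                                    (∀ {v} → old v ≡ false → prot st v ≡ true → Occupied st v) →
                                    ¬ HasFullLine sq old → HasFullLine sq (prot st) → SearchersInside sq st
    searchersInside-at-first-full-line sq old st frontier fresh no-old-line (inj₁ column) =
      rows-occupied⇒searchersInside sq {st}
        (every-row-occupied sq old st frontier fresh (λ a row → no-old-line (inj₂ (a , row))) column)
    searchersInside-at-first-full-line sq old st frontier fresh no-old-line (inj₂ row) =
      searchersInside-transpose sq {st} (rows-occupied⇒searchersInside (transpose sq) {st}
        (every-row-occupied (transpose sq) old st frontier fresh (λ b column → no-old-line (inj₁ (b , column))) row))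

    module _ {n : ℕ} (sq : Square n) (corner : Fin n) where

      first-full-line : ∀ {p : Fin m → V} {st f} (old : V → Bool) → Star Stage (initial p) st → Star Stage st f →
                   FrontierOccupied st → (∀ {v} → old v ≡ false → prot st v ≡ true → Occupied st v) →
                   ¬ HasFullLine sq old → AllProtected f →
                   ∃[ x ] (Star Stage (initial p) x × Star Stage x f × SearchersInside sq x)
      first-full-line {st = st} old before ε frontier fresh no-old-line all-protected =
        st , before , ε , searchersInside-at-first-full-line sq old st frontier fresh no-old-line
                            (inj₁ (corner , λ _ → all-protected _))
      first-full-line {st = st} old before (S ◅ after) frontier fresh no-old-line all-protected
        with hasFullLine? sq (prot st)
      ... | yes line = st , before , S ◅ after , searchersInside-at-first-full-line sq old st frontier fresh no-old-line line
      ... | no no-line = first-full-line (prot st) (before ◅◅ (S ◅ ε)) after (frontierOccupied-step S frontier)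
                                    (newly-protected-occupied S) no-line all-protected

      searchersInside-during-play : ∀ {p : Fin m → V} {f} → Star Stage (initial p) f → AllProtected f →
                                    ∃[ x ] (Star Stage (initial p) x × Star Stage x f × SearchersInside sq x)
      searchersInside-during-play {p} play all-protected =
        first-full-line (λ _ → false) ε play (frontierOccupied-initial p) (λ _ → initially-protected-occupied p)
                   nothing-full all-protected
        where
          nothing-full : ¬ HasFullLine sq (λ _ → false)
          nothing-full (inj₁ (b , column)) = contradiction (column b) λ ()
          nothing-full (inj₂ (a , row))    = contradiction (row a) λ ()

module GridGeometry (R N : ℕ) where
  open FinGraph (Grid R N) using (verts)
  open Shapes (Grid R N)

  Cell : Set
  Cell = Fin R × Fin N

  col : Cell → ℕ
  col (_ , c) = toℕ c

  gridAdj-cases : ∀ {a a′ : Fin R} {b b′ : Fin N} → T (gridAdj (a , b) (a′ , b′)) →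
                  (Consecutive a a′ × b ≡ b′) ⊎ (a ≡ a′ × Consecutive b b′)
  gridAdj-cases {a} {a′} {b} {b′} ab~a′b′ with to T-∨ ab~a′b′
  ... | inj₁ vertical   = let (x , y) = to T-∧ vertical in
                          inj₁ (to (T-does (_ Data.Nat.≟ 1)) x , to (T-does (b Data.Fin.≟ b′)) y)
  ... | inj₂ horizontal = let (x , y) = to T-∧ horizontal in
                          inj₂ (to (T-does (a Data.Fin.≟ a′)) x , to (T-does (_ Data.Nat.≟ 1)) y)

  gridAdj-vertical : ∀ {a a′ : Fin R} {b : Fin N} → Consecutive a a′ → T (gridAdj (a , b) (a′ , b))
  gridAdj-vertical {b = b} aa′ =
    from T-∨ (inj₁ (from T-∧ (from (T-does (_ Data.Nat.≟ 1)) aa′ , from (T-does (b Data.Fin.≟ b)) refl)))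

  gridAdj-horizontal : ∀ {a : Fin R} {b b′ : Fin N} → Consecutive b b′ → T (gridAdj (a , b) (a , b′))
  gridAdj-horizontal {a} bb′ =
    from T-∨ (inj₂ (from T-∧ (from (T-does (a Data.Fin.≟ a)) refl , from (T-does (_ Data.Nat.≟ 1)) bb′)))

  col-lipschitz : Lipschitz col
  col-lipschitz (a , b) (a′ , b′) vw with gridAdj-cases {a} {a′} {b} {b′} vw
  ... | inj₁ (_ , b≡b′) = subst (_≤ 1) (sym (m≡n⇒∣m-n∣≡0 (cong toℕ b≡b′))) z≤n
  ... | inj₂ (_ , bb′)  = ≤-reflexive bb′

  grid-complete : ∀ v → v ∈ verts
  grid-complete (a , b) = ∈-cartesianProduct⁺ (∈-allFin a) (∈-allFin b)

  grid-unique : Unique verts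
  grid-unique = cartesianProduct⁺ (allFin⁺ R) (allFin⁺ N)

  module Block (c₀ : ℕ) (fits : c₀ + R ≤ N) where

    column : Fin R → Fin N
    column b = fromℕ< (≤-trans (+-monoʳ-< c₀ (toℕ<n b)) fits)

    toℕ-column : ∀ b → toℕ (column b) ≡ c₀ + toℕ b
    toℕ-column b = toℕ-fromℕ< _

    square : Square R
    square = record
      { cell           = λ a b → a , column b
      ; cell-injective = λ eq → cong proj₁ eq , toℕ-injective (+-cancelˡ-≡ c₀ _ _
                           (trans (sym (toℕ-column _)) (trans (cong (toℕ ∘ proj₂) eq) (toℕ-column _))))
      ; adj-row        = λ a {b} {b′} bb′ → gridAdj-horizontal {a} {column b} {column b′}
                           (trans (cong₂ ∣_-_∣ (toℕ-column b) (toℕ-column b′)) (trans (∣m+n-m+o∣≡∣n-o∣ c₀ _ _) bb′))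
      ; adj-column     = λ b {a} {a′} → gridAdj-vertical {a} {a′} {column b}
      }

    inside-columns : ∀ {v} → Inside square v → c₀ ≤ col v × col v < c₀ + R
    inside-columns (a , b , refl) rewrite toℕ-column b = m≤m+n c₀ (toℕ b) , +-monoʳ-< c₀ (toℕ<n b)

module LowerBound (R N k : ℕ) (wide : k + R + R ≤ N) where
  open Game (Grid R N) k
  open Play (Grid R N) k
  open Shapes (Grid R N)
  open GridGeometry R N

  module Left  = Block 0 (≤-trans (m≤n+m R (k + R)) wide)
  module Right = Block (k + R) wide

  never-in-both-blocks : ∀ {m} {p : Fin m → Cell} {x y f} →
                         Star Stage (initial p) x → Star Stage x f → Star Stage (initial p) y → Star Stage y f →
                         ∀ i → Inside Left.square (pos x i) → ¬ Inside Right.square (pos y i)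
  never-in-both-blocks {x = x} {y} px xf py yf i left right = <-irrefl refl (begin-strict
    k + R                  ≤⟨ proj₁ (Right.inside-columns right) ⟩
    cy                     ≤⟨ m≤n+∣m-n∣ cy cx ⟩
    cx + ∣ cy - cx ∣        ≤⟨ +-monoʳ-≤ cx (subst (_≤ k) (∣-∣-comm cx cy) moved) ⟩
    cx + k                 <⟨ +-monoˡ-< k (proj₂ (Left.inside-columns left)) ⟩
    R + k                  ≡⟨ +-comm R k ⟩
    k + R                  ∎)
    where
      open ≤-Reasoning
      cx cy : ℕ
      cx = col (pos x i); cy = col (pos y i)
      moved : ∣ cx - cy ∣ ≤ k
      moved = displacement-within-play {φ = col} col-lipschitz px xf py yf i

  successful⇒R+R≤m : 1 ≤ R → ∀ {m} (p : Fin m → Cell) → Successful p → R + R ≤ m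
  successful⇒R+R≤m 1≤R p (f , play , all-protected)
    with searchersInside-during-play Left.square (fromℕ< 1≤R) play all-protected
       | searchersInside-during-play Right.square (fromℕ< 1≤R) play all-protected
  ... | x , px , xf , left , left-injective , in-left | y , py , yf , right , right-injective , in-right =
    injective⇒≤ (Composition.injective _≡_ _≡_ _≡_ {f = splitAt R} {g = [ left , right ]′}
                   (splitAt-injective R) (injective-[,] left-injective right-injective apart))
    where
      apart : ∀ a b → left a ≢ right b
      apart a b eq = never-in-both-blocks px xf py yf (left a) (in-left a)
                       (subst (Inside Right.square ∘ pos y) (sym eq) (in-right b))

module Sweep (R P k : ℕ) (short : P ≤ k + k) where
  open Game (Grid R (suc P)) k
  open Play (Grid R (suc P)) k
  open GridGeometry R (suc P)

  -- Column c, clamped to P: only c ≤ P ever occurs.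
  at : ℕ → Fin (suc P)
  at c = fromℕ< (s≤s (m⊓n≤n c P))

  toℕ-at : ∀ {c} → c ≤ P → toℕ (at c) ≡ c
  toℕ-at c≤P = trans (toℕ-fromℕ< _) (m≤n⇒m⊓n≡m c≤P)

  col≤P : ∀ (v : Cell) → col v ≤ P
  col≤P (_ , c) = s≤s⁻¹ (toℕ<n c)

  Gap : ℕ → ℕ → Set
  Gap t c = t < c × c < P ∸ t

  front : Fin 2 → ℕ → ℕ
  front zero       t = t
  front (suc zero) t = P ∸ t

  front≤P : ∀ s {t} → t ≤ P → front s t ≤ P
  front≤P zero       t≤P = t≤P
  front≤P (suc zero) {t} _ = m∸n≤m P t

  front∉gap : ∀ s t → ¬ Gap t (front s t)
  front∉gap zero       t (t<t , _) = <-irrefl refl t<t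
  front∉gap (suc zero) t (_ , c<c) = <-irrefl refl c<c

  P∸t≡1+P∸1+t : ∀ {t} → t < P → P ∸ t ≡ suc (P ∸ suc t)
  P∸t≡1+P∸1+t t<P = +-∸-assoc 1 t<P

  front-step : ∀ s {t} → t < P → ∣ front s t - front s (suc t) ∣ ≡ 1
  front-step zero       {t} _   = ∣n-1+n∣≡1 t
  front-step (suc zero) {t} t<P =
    trans (cong ∣_- P ∸ suc t ∣ (P∸t≡1+P∸1+t t<P)) (trans (∣-∣-comm (suc (P ∸ suc t)) (P ∸ suc t)) (∣n-1+n∣≡1 (P ∸ suc t)))

  front-in-gap : ∀ s {t} → suc t + suc t ≤ P → Gap t (front s (suc t))
  front-in-gap zero       {t} wide = n<1+n t , m+n≤o⇒m≤o∸n (suc (suc t)) (subst (_≤ P) (cong suc (+-suc t t)) wide)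
  front-in-gap (suc zero) {t} wide =
    m+n≤o⇒m≤o∸n (suc t) wide , subst (P ∸ suc t <_) (sym (P∸t≡1+P∸1+t (≤-trans (m≤m+n (suc t) (suc t)) wide))) (n<1+n _)

  front-only : ∀ s {t d} → t < P → Gap t d → ∣ front s t - d ∣ ≡ 1 → d ≡ front s (suc t)
  front-only zero       _   (t<d , _) step with ∣m-n∣≡1⇒n≡1+m⊎m≡1+n step
  ... | inj₁ d≡1+t = d≡1+t
  ... | inj₂ t≡1+d = contradiction (subst (_< _) t≡1+d t<d) (<-asym (n<1+n _))
  front-only (suc zero) t<P (_ , d<P∸t) step with ∣m-n∣≡1⇒n≡1+m⊎m≡1+n step
  ... | inj₁ d≡1+P∸t = contradiction (subst (_< _) d≡1+P∸t d<P∸t) (<-asym (n<1+n _))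
  ... | inj₂ P∸t≡1+d = suc-injective (trans (sym P∸t≡1+d) (P∸t≡1+P∸1+t t<P))

  place : ℕ → Fin 2 × Fin R → Cell
  place t (s , a) = a , at (front s t)

  layout : ℕ → Fin (2 * R) → Cell
  layout t = place t ∘ remQuot R

  swept : ℕ → Cell → Bool
  swept zero    = protectAfter (λ _ → false) (layout zero)
  swept (suc t) = protectAfter (swept t) (layout (suc t))

  sweep : ℕ → State (2 * R)
  sweep t = state (layout t) (λ _ → t) (swept t)

  layout-reaches : ∀ t s (w : Cell) → col w ≡ front s t → ∃[ i ] layout t i ≡ w
  layout-reaches t s (a , b) b≡front = combine s a , (begin
    layout t (combine s a)  ≡⟨ cong (place t) (remQuot-combine s a) ⟩
    a , at (front s t)      ≡⟨ cong (a ,_) (toℕ-injective (trans (toℕ-at (subst (_≤ P) b≡front (col≤P (a , b)))) (sym b≡front))) ⟩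
    a , b                   ∎)
    where open ≡-Reasoning

  swept-outside : ∀ t (w : Cell) → col w ≤ t ⊎ P ∸ t ≤ col w → swept t w ≡ true
  swept-outside zero w (inj₁ w≤0) = protectAfter-new (λ _ → false) (layout 0) (layout-reaches 0 zero w (n≤0⇒n≡0 w≤0))
  swept-outside zero w (inj₂ P≤w) =
    protectAfter-new (λ _ → false) (layout 0) (layout-reaches 0 (suc zero) w (≤-antisym (col≤P w) P≤w))
  swept-outside (suc t) w (inj₁ w≤1+t) with m≤n⇒m<n∨m≡n w≤1+t
  ... | inj₁ w<1+t = protectAfter-old (swept t) (layout (suc t)) (swept-outside t w (inj₁ (s≤s⁻¹ w<1+t)))
  ... | inj₂ w≡1+t = protectAfter-new (swept t) (layout (suc t)) (layout-reaches (suc t) zero w w≡1+t)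
  swept-outside (suc t) w (inj₂ P∸1+t≤w) with m≤n⇒m<n∨m≡n P∸1+t≤w
  ... | inj₁ P∸1+t<w =
    protectAfter-old (swept t) (layout (suc t)) (swept-outside t w (inj₂ (≤-trans (m∸n≤1+[m∸1+n] P t) P∸1+t<w)))
  ... | inj₂ P∸1+t≡w = protectAfter-new (swept t) (layout (suc t)) (layout-reaches (suc t) (suc zero) w (sym P∸1+t≡w))

  layout-avoids-gap : ∀ t w → Gap t (col w) → ∀ i → layout t i ≢ w
  layout-avoids-gap t w gap@(t<w , w<P∸t) i refl = front∉gap s t (subst (Gap t) (toℕ-at (front≤P s t≤P)) gap)
    where
      s : Fin 2
      s = proj₁ (remQuot R i)
      t≤P : t ≤ P
      t≤P = <⇒≤ (<-≤-trans t<w (≤-trans (<⇒≤ w<P∸t) (m∸n≤m P t)))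

  swept-gap : ∀ t (w : Cell) → Gap t (col w) → swept t w ≡ false
  swept-gap zero    w gap = protectAfter-false (λ _ → false) (layout 0) refl (layout-avoids-gap 0 w gap)
  swept-gap (suc t) w gap@(1+t<w , w<P∸1+t) =
    protectAfter-false (swept t) (layout (suc t))
      (swept-gap t w (<-trans (n<1+n t) 1+t<w , <-≤-trans w<P∸1+t (∸-monoʳ-≤ P (n≤1+n t))))
                       (layout-avoids-gap (suc t) w gap)

  unswept⇒gap : ∀ t (w : Cell) → swept t w ≡ false → Gap t (col w)
  unswept⇒gap t w unswept with col w ≤? t | P ∸ t ≤? col w
  ... | yes w≤t | _         = contradiction (trans (sym unswept) (swept-outside t w (inj₁ w≤t))) λ ()
  ... | no _    | yes P∸t≤w = contradiction (trans (sym unswept) (swept-outside t w (inj₂ P∸t≤w))) λ ()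
  ... | no w≰t  | no P∸t≰w  = ≰⇒> w≰t , ≰⇒> P∸t≰w

  col-place : ∀ t q → t ≤ P → col (place t q) ≡ front (proj₁ q) t
  col-place t (s , _) t≤P = toℕ-at (front≤P s t≤P)

  place-step : ∀ t q → t < P → T (gridAdj (place t q) (place (suc t) q))
  place-step t q@(s , a) t<P = gridAdj-horizontal {a} {at (front s t)} {at (front s (suc t))}
    (trans (cong₂ ∣_-_∣ (col-place t q (<⇒≤ t<P)) (col-place (suc t) q t<P)) (front-step s t<P))

  place-next-unswept : ∀ t q → suc t + suc t ≤ P → swept t (place (suc t) q) ≡ false
  place-next-unswept t q@(s , _) wide =
    swept-gap t _ (subst (Gap t) (sym (col-place (suc t) q (≤-trans (m≤m+n (suc t) (suc t)) wide))) (front-in-gap s wide))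

  place-only-unswept-neighbour : ∀ t q {w} → t < P → T (gridAdj (place t q) w) → swept t w ≡ false →
                                 w ≡ place (suc t) q
  place-only-unswept-neighbour t q@(s , a) {a′ , b′} t<P adjacent unswept
    with unswept⇒gap t (a′ , b′) unswept | gridAdj-cases {a} {a′} adjacent
  ... | gap | inj₁ (_ , same-column) =
    contradiction (subst (Gap t) (trans (cong toℕ (sym same-column)) (col-place t q (<⇒≤ t<P))) gap) (front∉gap s t)
  ... | gap | inj₂ (a≡a′ , consecutive) = cong₂ _,_ (sym a≡a′) (toℕ-injective (begin
    toℕ b′                     ≡⟨ front-only s t<P gap (trans (cong ∣_- toℕ b′ ∣ (sym (col-place t q (<⇒≤ t<P)))) consecutive) ⟩
    front s (suc t)            ≡⟨ col-place (suc t) q t<P ⟨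
    toℕ (at (front s (suc t))) ∎))
    where open ≡-Reasoning

  sweep-stage : ∀ t → suc t + suc t ≤ P → Stage (sweep t) (sweep (suc t))
  sweep-stage t wide =
    advance grid-complete grid-unique (sweep t) (layout (suc t))
      (λ _ → from (T-does (t <? k)) (m+m≤n+n⇒m≤n (≤-trans wide short)))
      (λ i → place-step t (remQuot R i) t<P)
      (λ i → place-next-unswept t (remQuot R i) wide)
      (λ i → place-only-unswept-neighbour t (remQuot R i) t<P)
    where
      t<P : t < P
      t<P = ≤-trans (m≤m+n (suc t) (suc t)) wide

  sweep-complete : ∀ t → P ≤ suc (t + t) → AllProtected (sweep t)
  sweep-complete t narrow w with col w ≤? t
  ... | yes w≤t = swept-outside t w (inj₁ w≤t)
  ... | no w≰t  = swept-outside t w (inj₂ (≤-trans (m≤n+o⇒m∸n≤o P t (subst (P ≤_) (sym (+-suc t t)) narrow)) (≰⇒> w≰t)))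

  sweep-reaches : ∀ t → t + t ≤ P → Star Stage (sweep 0) (sweep t)
  sweep-reaches zero    _    = ε
  sweep-reaches (suc t) wide = sweep-reaches t (≤-trans (+-mono-≤ (n≤1+n t) (n≤1+n t)) wide) ◅◅ (sweep-stage t wide ◅ ε)

  sweep-successful : Successful (layout 0)
  sweep-successful =
    let (lower , upper) = ⌊n/2⌋-bounds P in sweep ⌊ P /2⌋ , sweep-reaches ⌊ P /2⌋ lower , sweep-complete ⌊ P /2⌋ upper

corollary4p8 : (k r s : ℕ) → 1 ≤ k → 1 ≤ r → r ≤ k → 1 ≤ s → s ≤ k →
               2 * r ∸ 1 ≤ s →
               Game.IsDeductionNumber (Grid r (k + 1 + s)) k (2 * r)
corollary4p8 k r s _ 1≤r _ _ s≤k 2r∸1≤s = at-most , at-least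
  where
    r+r≡2*r : r + r ≡ 2 * r
    r+r≡2*r = cong (r +_) (sym (+-identityʳ r))

    at-most : ∃[ p ] Game.Successful (Grid r (k + 1 + s)) k {2 * r} p
    at-most = subst (λ N → ∃[ p ] Game.Successful (Grid r N) k {2 * r} p) (cong (_+ s) (+-comm 1 k))
                (_ , Sweep.sweep-successful r (k + s) k (+-monoʳ-≤ k s≤k))

    wide : k + r + r ≤ k + 1 + s
    wide = begin
      k + r + r   ≡⟨ trans (+-assoc k r r) (cong (k +_) r+r≡2*r) ⟩
      k + 2 * r   ≤⟨ +-monoʳ-≤ k (≤-trans (m≤n+m∸n (2 * r) 1) (+-monoʳ-≤ 1 2r∸1≤s)) ⟩
      k + (1 + s) ≡⟨ +-assoc k 1 s ⟨
      k + 1 + s   ∎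
      where open ≤-Reasoning

    at-least : ∀ m p → Game.Successful (Grid r (k + 1 + s)) k {m} p → 2 * r ≤ m
    at-least m p = subst (_≤ m) r+r≡2*r ∘ LowerBound.successful⇒R+R≤m r (k + 1 + s) k wide 1≤r p
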